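{- Let $G$ be a finite group of order $v$ and let $D = P - N$ be a $(v,k,\lambda)$ signed difference set in $G$ (with the convention $\lvert P\rvert \ge \lvert N\rvert$). Then $s = \sqrt{\lambda(v-1)+k}$ is an integer, and $$\lvert P\rvert = \frac{k+s}{2}, \qquad \lvert N\rvert = \frac{k-s}{2}.$$
   Context: Let $G$ be a finite group of order $v$ and $\mathbb{Z}[G]$ its integral group ring. A $(v,k,\lambda)$ signed difference set in $G$ is an element $D=\sum_{g\in G} s_g g\in\mathbb{Z}[G]$ with all $s_g\in\{ -1,0,1\}$ such that, writing $P=\{g: s_g=1\}$, $N=\{g:s_g=-1\}$ (so $D=P-N$ with sets identified with the sum of their elements) and $k=\lvert P\rvert+\lvert N\rvert$, one has $$D D^{(-1)} = n\cdot 1_G + \lambda \sum_{g\in G} g,\qquad n=k-\lambda,$$ where $D^{(-1)}=\sum_{g} s_g g^{ -1}$. By convention $P$ and $N$ are labeled so that $\lvert P\rvert\ge\lvert N\rvert$ (replacing $D$ by $-D$ if necessary). -}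

module Defs where

open import Data.Nat using (ℕ; zero; suc)
open import Data.Fin using (Fin; zero; suc)
open import Data.Integer using (ℤ; +_; -_; _+_; _*_; _-_; 0ℤ; 1ℤ)
open import Data.Integer.Properties using (_≟_)
open import Data.Fin.Properties renaming (_≟_ to _≟ᶠ_)
open import Relation.Nullary using (yes; no)
open import Relation.Binary.PropositionalEquality using (_≡_)
open import Data.Sum using (_⊎_)

-- A finite group of order v, with carrier Fin v (every finite group of
-- order v is isomorphic to one of this form) and propositional equality.
record FinGroup (v : ℕ) : Set where
  field
    _∙_   : Fin v → Fin v → Fin v
    e     : Fin v
    inv   : Fin v → Fin v
    assoc : ∀ x y z → ((x ∙ y) ∙ z) ≡ (x ∙ (y ∙ z))
    idˡ   : ∀ x → (e ∙ x) ≡ x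
    idʳ   : ∀ x → (x ∙ e) ≡ x
    invˡ  : ∀ x → (inv x ∙ x) ≡ e
    invʳ  : ∀ x → (x ∙ inv x) ≡ e

Σℤ : {n : ℕ} → (Fin n → ℤ) → ℤ
Σℤ {zero}  f = 0ℤ
Σℤ {suc n} f = f zero + Σℤ (λ i → f (suc i))

count : {n : ℕ} → (Fin n → ℤ) → ℤ → ℕ
count {zero}  f c = zero
count {suc n} f c with f zero ≟ c
... | yes _ = suc (count (λ i → f (suc i)) c)
... | no  _ = count (λ i → f (suc i)) c

-- An element D = Σ s_g g of ℤ[G]; coefficients in {-1,0,1}
Signed : {v : ℕ} → (Fin v → ℤ) → Set
Signed s = ∀ g → (s g ≡ - 1ℤ) ⊎ ((s g ≡ 0ℤ) ⊎ (s g ≡ 1ℤ))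

sizeP sizeN : {v : ℕ} → (Fin v → ℤ) → ℕ
sizeP s = count s 1ℤ
sizeN s = count s (- 1ℤ)

-- coefficient of h in D D^(-1) = Σ_{a,b} s_a s_b a b^{-1}:
-- a b^{-1} = h  iff  b = h^{-1} a
coeffDD⁻¹ : {v : ℕ} → FinGroup v → (Fin v → ℤ) → Fin v → ℤ
coeffDD⁻¹ G s h = Σℤ (λ a → s a * s (inv h ∙ a))
  where open FinGroup G

-- coefficient of h in n·1_G + λ Σ_g g
coeffRHS : {v : ℕ} → FinGroup v → ℤ → ℤ → Fin v → ℤ
coeffRHS G n λ' h with h ≟ᶠ FinGroup.e G
... | yes _ = n + λ'
... | no  _ = λ'

record IsSignedDiffSet {v : ℕ} (G : FinGroup v) (k : ℕ) (λ' : ℤ) (s : Fin v → ℤ) : Set where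
  field
    signed : Signed s
    k≡     : k ≡ sizeP s Data.Nat.+ sizeN s
    eqn    : ∀ h → coeffDD⁻¹ G s h ≡ coeffRHS G (+ k - λ') λ' h

{-# OPTIONS --safe #-}

-- Apply the augmentation map ε(Σ a_g g) = Σ a_g to D D^(-1) = n·1 + λ·G.
-- Since ε is multiplicative and ε(D^(-1)) = ε(D), this gives
-- ε(D)² = n + λv = λ(v-1) + k, while ε(D) = |P| - |N| ≥ 0.  Hence
-- s = |P| - |N|, and together with |P| + |N| = k this determines |P| and |N|.

module Submission where

open import Defs
open import Algebra.Bundles using (Group)
open import Data.Bool using (Bool; true; false)
open import Data.Fin using (Fin; zero; suc; punchIn)
open import Data.Fin.Permutation using (Permutation; permutation)
open import Data.Fin.Properties using (punchInᵢ≢i) renaming (_≟_ to _≟ᶠ_)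
open import Data.Integer using (ℤ; +_; -_; _+_; _*_; _-_; 0ℤ; 1ℤ)
open import Data.Integer.Properties as ℤ using (_≟_; +-*-semiring)
open import Data.Integer.Tactic.RingSolver using (solve-∀)
open import Data.Nat using (ℕ; _≥_)
import Data.Nat as ℕ
open import Data.Nat.Properties using (m≤n⇒∃[o]m+o≡n)
open import Data.Product using (∃; _×_; _,_)
open import Data.Sum using (_⊎_; inj₁; inj₂)
open import Level using (0ℓ)
open import Relation.Binary.PropositionalEquality
  using (_≡_; _≢_; refl; sym; trans; cong; cong₂; isEquivalence; module ≡-Reasoning)
open import Relation.Nullary using (does; yes; no; contradiction)

open import Algebra.Properties.Semiring.Sum +-*-semiring
  using (sum; sum-cong-≗; ∑-comm; sum-permute; sum-remove; *-distribˡ-sum; *-distribʳ-sum)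

open ≡-Reasoning

Σℤ≡sum : ∀ {n} (f : Fin n → ℤ) → Σℤ f ≡ sum f
Σℤ≡sum {ℕ.zero}  f = refl
Σℤ≡sum {ℕ.suc n} f = cong (_+_ (f zero)) (Σℤ≡sum (λ i → f (suc i)))

Σℤ-cong : ∀ {n} {f g : Fin n → ℤ} → (∀ i → f i ≡ g i) → Σℤ f ≡ Σℤ g
Σℤ-cong {ℕ.zero}  f≗g = refl
Σℤ-cong {ℕ.suc n} f≗g = cong₂ _+_ (f≗g zero) (Σℤ-cong (λ i → f≗g (suc i)))

sum-const : ∀ n (c : ℤ) → sum {n} (λ _ → c) ≡ + n * c
sum-const ℕ.zero    c = sym (ℤ.*-zeroˡ c)
sum-const (ℕ.suc n) c = trans (cong (_+_ c) (sum-const n c)) (distrib c (+ n))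
  where
  distrib : ∀ c m → c + m * c ≡ (+ 1 + m) * c
  distrib = solve-∀

module _ {v : ℕ} (G : FinGroup v) where
  open FinGroup G

  asGroup : Group 0ℓ 0ℓ
  asGroup = record
    { Carrier = Fin v ; _≈_ = _≡_ ; _∙_ = _∙_ ; ε = e ; _⁻¹ = inv
    ; isGroup = record
      { isMonoid = record
        { isSemigroup = record
          { isMagma = record { isEquivalence = isEquivalence ; ∙-cong = cong₂ _∙_ }
          ; assoc = assoc }
        ; identity = idˡ , idʳ }
      ; inverse = invˡ , invʳ
      ; ⁻¹-cong = cong inv } }

  open Group asGroup using (_\\_; _//_)
  open import Algebra.Properties.Group asGroup
    using (\\-leftDividesˡ; \\-leftDividesʳ; //-rightDividesˡ; //-rightDividesʳ)

  leftDivisionInto : Fin v → Permutation v v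
  leftDivisionInto a = permutation (_\\ a) (a //_) divide-multiply multiply-divide
    where
    divide-multiply : ∀ b → (a // b) \\ a ≡ b
    divide-multiply b = begin
      (a // b) \\ a              ≡⟨ cong ((a // b) \\_) (//-rightDividesˡ b a) ⟨
      (a // b) \\ ((a // b) ∙ b) ≡⟨ \\-leftDividesʳ (a // b) b ⟩
      b                          ∎
    multiply-divide : ∀ h → a // (h \\ a) ≡ h
    multiply-divide h = begin
      a // (h \\ a)                ≡⟨ cong (_// (h \\ a)) (\\-leftDividesˡ h a) ⟨
      (h ∙ (h \\ a)) // (h \\ a)   ≡⟨ //-rightDividesʳ (h \\ a) h ⟩
      h                            ∎

  sum-leftDivision : ∀ (f : Fin v → ℤ) a → sum (λ h → f (h \\ a)) ≡ sum f
  sum-leftDivision f a = sym (sum-permute f (leftDivisionInto a))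

  Σℤ-coeffDD⁻¹ : (s : Fin v → ℤ) → Σℤ (coeffDD⁻¹ G s) ≡ Σℤ s * Σℤ s
  Σℤ-coeffDD⁻¹ s = begin
    Σℤ (λ h → Σℤ (λ a → s a * s (h \\ a)))
      ≡⟨ trans (Σℤ≡sum (coeffDD⁻¹ G s)) (sum-cong-≗ (λ h → Σℤ≡sum (λ a → s a * s (h \\ a)))) ⟩
    sum (λ h → sum (λ a → s a * s (h \\ a))) ≡⟨ ∑-comm (λ h a → s a * s (h \\ a)) ⟩
    sum (λ a → sum (λ h → s a * s (h \\ a))) ≡⟨ sum-cong-≗ (λ a → *-distribˡ-sum (s a) (λ h → s (h \\ a))) ⟨
    sum (λ a → s a * sum (λ h → s (h \\ a))) ≡⟨ sum-cong-≗ (λ a → cong (s a *_) (sum-leftDivision s a)) ⟩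
    sum (λ a → s a * sum s)                  ≡⟨ *-distribʳ-sum (sum s) s ⟨
    sum s * sum s                            ≡⟨ cong₂ _*_ (Σℤ≡sum s) (Σℤ≡sum s) ⟨
    Σℤ s * Σℤ s                              ∎

coeffRHS-identity : ∀ {v} (G : FinGroup v) m l → coeffRHS G m l (FinGroup.e G) ≡ m + l
coeffRHS-identity G m l with FinGroup.e G ≟ᶠ FinGroup.e G
... | yes _  = refl
... | no e≢e = contradiction refl e≢e

coeffRHS-nonidentity : ∀ {v} (G : FinGroup v) m l {h} → h ≢ FinGroup.e G → coeffRHS G m l h ≡ l
coeffRHS-nonidentity G m l {h} h≢e with h ≟ᶠ FinGroup.e G
... | yes h≡e = contradiction h≡e h≢e
... | no _    = refl

Σℤ-coeffRHS : ∀ {v} (G : FinGroup v) m l → Σℤ (coeffRHS G m l) ≡ m + + v * l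
Σℤ-coeffRHS {ℕ.zero}  G m l with () ← FinGroup.e G
Σℤ-coeffRHS {ℕ.suc w} G m l = begin
  Σℤ (coeffRHS G m l)                                ≡⟨ Σℤ≡sum (coeffRHS G m l) ⟩
  sum (coeffRHS G m l)                               ≡⟨ sum-remove {i = e} (coeffRHS G m l) ⟩
  coeffRHS G m l e + sum (λ j → coeffRHS G m l (punchIn e j))
    ≡⟨ cong₂ _+_ (coeffRHS-identity G m l)
                 (sum-cong-≗ {w} (λ j → coeffRHS-nonidentity G m l (punchInᵢ≢i e j))) ⟩
  m + l + sum {w} (λ _ → l)                          ≡⟨ cong (_+_ (m + l)) (sum-const w l) ⟩
  m + l + + w * l                                    ≡⟨ regroup m l (+ w) ⟩
  m + (+ 1 + + w) * l                                ∎
  where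
  e = FinGroup.e G
  regroup : ∀ m l w → m + l + w * l ≡ m + (+ 1 + w) * l
  regroup = solve-∀

indicator : Bool → ℤ
indicator true  = 1ℤ
indicator false = 0ℤ

count-suc : ∀ {n} (f : Fin (ℕ.suc n) → ℤ) c →
            + count f c ≡ indicator (does (f zero ≟ c)) + + count (λ i → f (suc i)) c
count-suc f c with f zero ≟ c
... | yes _ = refl
... | no _  = sym (ℤ.+-identityˡ _)

signed-coefficient : ∀ {x} → (x ≡ - 1ℤ) ⊎ (x ≡ 0ℤ) ⊎ (x ≡ 1ℤ) →
                     x ≡ indicator (does (x ≟ 1ℤ)) - indicator (does (x ≟ - 1ℤ))
signed-coefficient (inj₁ refl)        = refl
signed-coefficient (inj₂ (inj₁ refl)) = refl
signed-coefficient (inj₂ (inj₂ refl)) = refl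

Σℤ-signed : ∀ {n} (s : Fin n → ℤ) → Signed s → Σℤ s ≡ + sizeP s - + sizeN s
Σℤ-signed {ℕ.zero}  s signed = refl
Σℤ-signed {ℕ.suc n} s signed = begin
  s zero + Σℤ t
    ≡⟨ cong₂ _+_ (signed-coefficient (signed zero)) (Σℤ-signed t (λ i → signed (suc i))) ⟩
  (pₒ - nₒ) + (+ sizeP t - + sizeN t) ≡⟨ interchange pₒ nₒ (+ sizeP t) (+ sizeN t) ⟩
  (pₒ + + sizeP t) - (nₒ + + sizeN t) ≡⟨ cong₂ _-_ (count-suc s 1ℤ) (count-suc s (- 1ℤ)) ⟨
  + sizeP s - + sizeN s               ∎
  where
  t = λ i → s (suc i)
  pₒ = indicator (does (s zero ≟ 1ℤ))
  nₒ = indicator (does (s zero ≟ - 1ℤ))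
  interchange : ∀ a b c d → (a - b) + (c - d) ≡ (a + c) - (b + d)
  interchange = solve-∀

sizes-from-difference : ∀ {p q r k} → q ℕ.+ r ≡ p → k ≡ p ℕ.+ q →
                        (+ p - + q ≡ + r) × (+ 2 * + p ≡ + k + + r) × (+ 2 * + q ≡ + k - + r)
sizes-from-difference {q = q} {r} refl refl
  rewrite ℤ.pos-+ (q ℕ.+ r) q | ℤ.pos-+ q r
  = difference (+ q) (+ r) , twice-p (+ q) (+ r) , twice-q (+ q) (+ r)
  where
  difference : ∀ q r → (q + r) - q ≡ r
  difference = solve-∀
  twice-p : ∀ q r → + 2 * (q + r) ≡ (q + r + q) + r
  twice-p = solve-∀
  twice-q : ∀ q r → + 2 * q ≡ (q + r + q) - r
  twice-q = solve-∀

lemma1 : (v : ℕ) (G : FinGroup v) (k : ℕ) (λ' : ℤ) (s : Fin v → ℤ) →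
    IsSignedDiffSet G k λ' s → sizeP s ≥ sizeN s →
    ∃ λ (r : ℕ) → ((+ r) * (+ r) ≡ λ' * (+ v - + 1) + + k)
    × ((+ 2) * (+ sizeP s) ≡ + k + + r)
    × ((+ 2) * (+ sizeN s) ≡ + k - + r)
lemma1 v G k λ' s D P≥N with m≤n⇒∃[o]m+o≡n P≥N
... | r , N+r≡P with sizes-from-difference N+r≡P (IsSignedDiffSet.k≡ D)
... | P-N≡r , twiceP , twiceN = r , square , twiceP , twiceN
  where
  Σs≡r : Σℤ s ≡ + r
  Σs≡r = trans (Σℤ-signed s (IsSignedDiffSet.signed D)) P-N≡r
  rearrange : ∀ k l v → (k - l) + v * l ≡ l * (v - + 1) + k
  rearrange = solve-∀
  square : + r * + r ≡ λ' * (+ v - + 1) + + k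
  square = begin
    + r * + r                      ≡⟨ cong₂ _*_ Σs≡r Σs≡r ⟨
    Σℤ s * Σℤ s                    ≡⟨ Σℤ-coeffDD⁻¹ G s ⟨
    Σℤ (coeffDD⁻¹ G s)             ≡⟨ Σℤ-cong (IsSignedDiffSet.eqn D) ⟩
    Σℤ (coeffRHS G (+ k - λ') λ')  ≡⟨ Σℤ-coeffRHS G (+ k - λ') λ' ⟩
    (+ k - λ') + + v * λ'          ≡⟨ rearrange (+ k) λ' (+ v) ⟩
    λ' * (+ v - + 1) + + k         ∎
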